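{- If $G$ and $H$ are connected graphs both having order at least $3$ and girth at least $4$, then $G \Box H$ is not well-covered.
   Context: All graphs are finite and simple. A graph is well-covered if all its maximal independent sets have the same cardinality. The girth of a graph is the length of its shortest cycle ($\infty$ for forests). The Cartesian product $G \Box H$ has vertex set $V(G)\times V(H)$, with $(g_1,h_1)$ adjacent to $(g_2,h_2)$ if either $g_1=g_2$ and $h_1h_2\in E(H)$, or $h_1=h_2$ and $g_1g_2\in E(G)$. -}

module Defs where

open import Data.Nat using (ℕ; _*_; _≤_)
open import Data.Fin using (Fin; remQuot)
open import Data.Fin.Subset using (Subset; _∈_; _∉_; _∪_; ⁅_⁆; ∣_∣)
open import Data.Bool using (Bool; true; false; T; _∨_; _∧_)
open import Data.Product using (_×_; _,_; ∃; ∃-syntax)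
open import Data.List using (List; []; _∷_)
open import Relation.Binary.PropositionalEquality using (_≡_)
open import Relation.Nullary using (¬_)

record Graph (n : ℕ) : Set where
  field
    adj   : Fin n → Fin n → Bool
    irrefl : ∀ v → adj v v ≡ false
    sym   : ∀ u v → adj u v ≡ adj v u
open Graph public

order : ∀ {n} → Graph n → ℕ
order {n} _ = n

Adj : ∀ {n} → Graph n → Fin n → Fin n → Set
Adj G u v = T (adj G u v)

-- a walk from u to v given as the list of intermediate-and-final vertices
Walk : ∀ {n} → Graph n → Fin n → List (Fin n) → Fin n → Set
Walk G u []       v = u ≡ v
Walk G u (w ∷ ws) v = Adj G u w × Walk G w ws v

Connected : ∀ {n} → Graph n → Set
Connected G = ∀ u v → ∃[ ws ] Walk G u ws v

-- girth ≥ 4: the graph has no cycle of length 3 (cycles in simple graphs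
-- have length ≥ 3), i.e. no three pairwise adjacent vertices.
GirthAtLeast4 : ∀ {n} → Graph n → Set
GirthAtLeast4 G = ∀ u v w → ¬ (Adj G u v × Adj G v w × Adj G w u)

Independent : ∀ {n} → Graph n → Subset n → Set
Independent G S = ∀ u v → u ∈ S → v ∈ S → ¬ Adj G u v

MaximalIndependent : ∀ {n} → Graph n → Subset n → Set
MaximalIndependent G S =
  Independent G S × (∀ v → v ∉ S → ¬ Independent G (S ∪ ⁅ v ⁆))

WellCovered : ∀ {n} → Graph n → Set
WellCovered G = ∀ S T → MaximalIndependent G S → MaximalIndependent G T → ∣ S ∣ ≡ ∣ T ∣

-- Cartesian product G □ H on Fin (m * n), vertex i ↔ remQuot n i : Fin m × Fin n
_□_ : ∀ {m n} → Graph m → Graph n → Graph (m * n)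
_□_ {m} {n} G H = record
  { adj = λ i j → prodAdj (remQuot n i) (remQuot n j)
  ; irrefl = λ i → irr (remQuot n i)
  ; sym = λ i j → sy (remQuot n i) (remQuot n j)
  }
  where
  open import Data.Fin using (_≟_)
  open import Relation.Nullary using (does)
  open import Relation.Binary.PropositionalEquality using (refl; cong₂)
  open import Data.Bool.Properties using (∨-comm)
  prodAdj : Fin m × Fin n → Fin m × Fin n → Bool
  prodAdj (g₁ , h₁) (g₂ , h₂) =
    (does (g₁ ≟ g₂) ∧ adj H h₁ h₂) ∨ (does (h₁ ≟ h₂) ∧ adj G g₁ g₂)
  irr : ∀ p → prodAdj p p ≡ false
  irr (g , h) rewrite irrefl H h | irrefl G g = aux (does (g ≟ g)) (does (h ≟ h))
    where
    aux : ∀ a b → (a ∧ false) ∨ (b ∧ false) ≡ false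
    aux false false = refl
    aux false true = refl
    aux true false = refl
    aux true true = refl
  eqsym : ∀ {k} (a b : Fin k) → does (a ≟ b) ≡ does (b ≟ a)
  eqsym a b with a ≟ b | b ≟ a
  ... | Relation.Nullary.yes _ | Relation.Nullary.yes _ = refl
  ... | Relation.Nullary.no _ | Relation.Nullary.no _ = refl
  ... | Relation.Nullary.yes p | Relation.Nullary.no q = Data.Empty.⊥-elim (q (Relation.Binary.PropositionalEquality.sym p))
    where import Data.Empty
  ... | Relation.Nullary.no q | Relation.Nullary.yes p = Data.Empty.⊥-elim (q (Relation.Binary.PropositionalEquality.sym p))
    where import Data.Empty
  sy : ∀ p q → prodAdj p q ≡ prodAdj q p
  sy (g₁ , h₁) (g₂ , h₂) =
    cong₂ _∨_ (cong₂ _∧_ (eqsym g₁ g₂) (Graph.sym H h₁ h₂))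
              (cong₂ _∧_ (eqsym h₁ h₂) (Graph.sym G g₁ g₂))

-- A connected graph with at least three vertices has a vertex a with two distinct
-- neighbours b and a′; let v, with distinct neighbours y and w, be such a vertex of H.
-- In G □ H take x = (b , y), b₁ = (a , y), b₂ = (b , v) and
--   S = ((N(a) ∖ {b}) × N(y)) ∪ (N(b) × (N(v) ∖ {y})) ∪ {x}.
-- Triangle-freeness makes S independent, and every neighbour of b₁ or b₂ other than x
-- has a neighbour in S. So in a maximal independent set M ⊇ S the vertex x can be
-- replaced by the non-adjacent pair b₁, b₂, and any maximal extension of the result
-- is larger than M.

module Submission where

open import Defs hiding (sym)
open import Level using (0ℓ)
open import Data.Nat using (ℕ; suc; _+_; _≤_; _<_; z≤n; s≤s)
open import Data.Nat.Properties using (≤-trans; <-irrefl; +-suc; +-comm; n≤1+n; ≤-reflexive; module ≤-Reasoning)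
open import Data.Fin using (Fin; zero; suc; _≟_; remQuot)
open import Data.Fin.Properties using (all?; any?; *↔×)
open import Data.Fin.Subset using (Subset; inside; outside; _∈_; _∉_; _∪_; _─_; _-_; ⁅_⁆; ∣_∣; _⊆_; _⊂_; _⊃_)
open import Data.Fin.Subset.Properties
  using (_∈?_; p⊆p∪q; x∈p∪q⁺; x∈p∪q⁻; x∈⁅x⁆; x∈⁅y⁆⇒x≡y; ∣⁅x⁆∣≡1; p─q⊆p; x∈p∧x≢y⇒x∈p-y; p⊆q⇒∣p∣≤∣q∣; p⊂q⇒∣p∣<∣q∣)
open import Data.Fin.Subset.Induction using (Acc; acc; ⊃-wellFounded)
open import Data.Vec using ([]; _∷_; tabulate; here; there)
open import Data.Vec.Properties using (lookup∘tabulate; lookup⇒[]=; []=⇒lookup)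
open import Data.Bool using (Bool; T; T?; _∧_; _∨_)
open import Data.Bool.Properties using (T-∧; T-∨)
open import Data.List using ([]; _∷_)
open import Data.Product using (_×_; _,_; proj₁; proj₂; ∃-syntax)
open import Data.Sum using (_⊎_; inj₁; inj₂; [_,_]′; map; map₂)
open import Data.Empty using (⊥-elim)
open import Function using (_∘_; id)
open import Function.Bundles using (_⇔_; mk⇔; Equivalence; _↔_; Inverse)
open import Relation.Unary using (Pred; Decidable)
open import Relation.Nullary using (¬_; Dec; yes; no; does; proof)
open import Relation.Nullary.Reflects using (Reflects; invert)
open import Relation.Nullary.Decidable using (dec-true; _×-dec_; _⊎-dec_; _→-dec_; ¬?)
open import Relation.Binary.PropositionalEquality using (_≡_; _≢_; refl; sym; trans; cong; subst)

∣p∪q∣≤∣p∣+∣q∣ : ∀ {n} (p q : Subset n) → ∣ p ∪ q ∣ ≤ ∣ p ∣ + ∣ q ∣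
∣p∪q∣≤∣p∣+∣q∣ []            []            = z≤n
∣p∪q∣≤∣p∣+∣q∣ (outside ∷ p) (outside ∷ q) = ∣p∪q∣≤∣p∣+∣q∣ p q
∣p∪q∣≤∣p∣+∣q∣ (inside  ∷ p) (outside ∷ q) = s≤s (∣p∪q∣≤∣p∣+∣q∣ p q)
∣p∪q∣≤∣p∣+∣q∣ (outside ∷ p) (inside  ∷ q) =
  ≤-trans (s≤s (∣p∪q∣≤∣p∣+∣q∣ p q)) (≤-reflexive (sym (+-suc ∣ p ∣ ∣ q ∣)))
∣p∪q∣≤∣p∣+∣q∣ (inside  ∷ p) (inside  ∷ q) =
  s≤s (≤-trans (∣p∪q∣≤∣p∣+∣q∣ p q) (≤-trans (n≤1+n _) (≤-reflexive (sym (+-suc ∣ p ∣ ∣ q ∣)))))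

x∈p─q⇒x∉q : ∀ {n} {x : Fin n} (p q : Subset n) → x ∈ p ─ q → x ∉ q
x∈p─q⇒x∉q (_ ∷ p) (inside  ∷ q) ()        here
x∈p─q⇒x∉q (_ ∷ p) (outside ∷ q) here      ()
x∈p─q⇒x∉q (_ ∷ p) (_       ∷ q) (there x∈) (there x∈q) = x∈p─q⇒x∉q p q x∈ x∈q

x∈p-y⇒x≢y : ∀ {n} {x y : Fin n} (p : Subset n) → x ∈ p - y → x ≢ y
x∈p-y⇒x≢y {y = y} p x∈ refl = x∈p─q⇒x∉q p ⁅ y ⁆ x∈ (x∈⁅x⁆ y)

∣p∣≤1+∣p-x∣ : ∀ {n} (p : Subset n) x → ∣ p ∣ ≤ suc ∣ p - x ∣
∣p∣≤1+∣p-x∣ p x = begin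
  ∣ p ∣                   ≤⟨ p⊆q⇒∣p∣≤∣q∣ p⊆p-x∪x ⟩
  ∣ (p - x) ∪ ⁅ x ⁆ ∣     ≤⟨ ∣p∪q∣≤∣p∣+∣q∣ (p - x) ⁅ x ⁆ ⟩
  ∣ p - x ∣ + ∣ ⁅ x ⁆ ∣   ≡⟨ cong (∣ p - x ∣ +_) (∣⁅x⁆∣≡1 x) ⟩
  ∣ p - x ∣ + 1           ≡⟨ +-comm ∣ p - x ∣ 1 ⟩
  suc ∣ p - x ∣           ∎
  where
  open ≤-Reasoning
  p⊆p-x∪x : p ⊆ (p - x) ∪ ⁅ x ⁆
  p⊆p-x∪x {u} u∈p with u ≟ x
  ... | yes refl = x∈p∪q⁺ (inj₂ (x∈⁅x⁆ x))
  ... | no u≢x   = x∈p∪q⁺ (inj₁ (x∈p∧x≢y⇒x∈p-y u∈p u≢x))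

x∈p∪⁅y⁆⁻ : ∀ {n} {p : Subset n} {x y} → x ∈ p ∪ ⁅ y ⁆ → x ∈ p ⊎ x ≡ y
x∈p∪⁅y⁆⁻ {p = p} {y = y} x∈ = map₂ (x∈⁅y⁆⇒x≡y y) (x∈p∪q⁻ p ⁅ y ⁆ x∈)

x∉p⇒p⊂p∪⁅x⁆ : ∀ {n} {p : Subset n} {x} → x ∉ p → p ⊂ p ∪ ⁅ x ⁆
x∉p⇒p⊂p∪⁅x⁆ {x = x} x∉p = p⊆p∪q ⁅ x ⁆ , x , x∈p∪q⁺ (inj₂ (x∈⁅x⁆ x)) , x∉p

x∉p⇒∣p∣<∣p∪⁅x⁆∣ : ∀ {n} {p : Subset n} {x} → x ∉ p → ∣ p ∣ < ∣ p ∪ ⁅ x ⁆ ∣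
x∉p⇒∣p∣<∣p∪⁅x⁆∣ = p⊂q⇒∣p∣<∣q∣ ∘ x∉p⇒p⊂p∪⁅x⁆

∣p∣<∣p-x∪⁅y⁆∪⁅z⁆∣ : ∀ {n} {p : Subset n} {x y z} → y ∉ p → z ∉ p → y ≢ z →
                    ∣ p ∣ < ∣ ((p - x) ∪ ⁅ y ⁆) ∪ ⁅ z ⁆ ∣
∣p∣<∣p-x∪⁅y⁆∪⁅z⁆∣ {p = p} {x} {y} {z} y∉p z∉p y≢z = begin-strict
  ∣ p ∣                          ≤⟨ ∣p∣≤1+∣p-x∣ p x ⟩
  suc ∣ p - x ∣                  <⟨ s≤s (x∉p⇒∣p∣<∣p∪⁅x⁆∣ (y∉p ∘ p─q⊆p p ⁅ x ⁆)) ⟩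
  suc ∣ (p - x) ∪ ⁅ y ⁆ ∣        ≤⟨ x∉p⇒∣p∣<∣p∪⁅x⁆∣ z∉p-x∪y ⟩
  ∣ ((p - x) ∪ ⁅ y ⁆) ∪ ⁅ z ⁆ ∣    ∎
  where
  open ≤-Reasoning
  z∉p-x∪y : z ∉ (p - x) ∪ ⁅ y ⁆
  z∉p-x∪y z∈ = [ z∉p ∘ p─q⊆p p ⁅ x ⁆ , y≢z ∘ sym ]′ (x∈p∪⁅y⁆⁻ z∈)

subset : ∀ {n} {P : Pred (Fin n) 0ℓ} → Decidable P → Subset n
subset P? = tabulate (does ∘ P?)

∈-subset⁺ : ∀ {n} {P : Pred (Fin n) 0ℓ} (P? : Decidable P) {i} → P i → i ∈ subset P?
∈-subset⁺ P? {i} Pi = lookup⇒[]= i (subset P?) (trans (lookup∘tabulate (does ∘ P?) i) (dec-true (P? i) Pi))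

∈-subset⁻ : ∀ {n} {P : Pred (Fin n) 0ℓ} (P? : Decidable P) {i} → i ∈ subset P? → P i
∈-subset⁻ {P = P} P? {i} i∈ =
  invert (subst (Reflects (P i)) (trans (sym (lookup∘tabulate (does ∘ P?) i)) ([]=⇒lookup i∈)) (proof (P? i)))

module _ {m : ℕ} (G : Graph m) where

  Adj-sym : ∀ {u v} → Adj G u v → Adj G v u
  Adj-sym {u} {v} = subst T (Graph.sym G u v)

  Adj⇒≢ : ∀ {u v} → Adj G u v → u ≢ v
  Adj⇒≢ {u} u~u refl = subst T (irrefl G u) u~u

  Cherry : Set
  Cherry = ∃[ c ] ∃[ u ] ∃[ w ] Adj G c u × Adj G c w × u ≢ w

  walk-leaving-edge⇒cherry : ∀ {u v c t} ws → Adj G u v → c ≡ u ⊎ c ≡ v →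
                             Walk G c ws t → t ≢ u → t ≢ v → Cherry
  walk-leaving-edge⇒cherry [] _ c∈uv refl t≢u t≢v = ⊥-elim ([ t≢u , t≢v ]′ c∈uv)
  walk-leaving-edge⇒cherry {u} {v} (d ∷ ws) u~v c∈uv (c~d , walk) t≢u t≢v with d ≟ u | d ≟ v
  ... | yes d≡u | _        = walk-leaving-edge⇒cherry ws u~v (inj₁ d≡u) walk t≢u t≢v
  ... | no _    | yes d≡v  = walk-leaving-edge⇒cherry ws u~v (inj₂ d≡v) walk t≢u t≢v
  ... | no d≢u  | no d≢v with c∈uv
  ...   | inj₁ refl = u , v , d , u~v , c~d , d≢v ∘ sym
  ...   | inj₂ refl = v , u , d , Adj-sym u~v , c~d , d≢u ∘ sym

  connected⇒cherry : Connected G → 3 ≤ m → Cherry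
  connected⇒cherry conn (s≤s (s≤s (s≤s _))) with conn zero (suc zero)
  ... | [] , ()
  ... | d ∷ _ , 0~d , _ with d ≟ suc zero
  ...   | yes refl = walk-leaving-edge⇒cherry _ 0~d (inj₁ refl) (proj₂ (conn zero (suc (suc zero))))
                                             (λ ()) (λ ())
  ...   | no d≢1   = walk-leaving-edge⇒cherry _ 0~d (inj₁ refl) (proj₂ (conn zero (suc zero)))
                                             (λ ()) (d≢1 ∘ sym)

  common-neighbour⇒¬Adj : GirthAtLeast4 G → ∀ {c u w} → Adj G c u → Adj G c w → ¬ Adj G u w
  common-neighbour⇒¬Adj girth {c} {u} {w} c~u c~w u~w = girth c u w (c~u , u~w , Adj-sym c~w)

  independent? : ∀ S → Dec (Independent G S)
  independent? S = all? λ u → all? λ v → u ∈? S →-dec v ∈? S →-dec ¬? (T? (adj G u v))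

  Independent-⊆ : ∀ {S T} → T ⊆ S → Independent G S → Independent G T
  Independent-⊆ T⊆S S-ind u v u∈T v∈T = S-ind u v (T⊆S u∈T) (T⊆S v∈T)

  Independent-∪⁅⁆ : ∀ {S v} → Independent G S → (∀ {u} → u ∈ S → ¬ Adj G u v) →
                    Independent G (S ∪ ⁅ v ⁆)
  Independent-∪⁅⁆ S-ind v-free u w u∈ w∈ with x∈p∪⁅y⁆⁻ u∈ | x∈p∪⁅y⁆⁻ w∈
  ... | inj₁ u∈S | inj₁ w∈S = S-ind u w u∈S w∈S
  ... | inj₁ u∈S | inj₂ refl = v-free u∈S
  ... | inj₂ refl | inj₁ w∈S = v-free w∈S ∘ Adj-sym
  ... | inj₂ refl | inj₂ refl = λ v~v → Adj⇒≢ v~v refl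

  extend-to-maximal : ∀ {S} → Independent G S → ∃[ M ] MaximalIndependent G M × S ⊆ M
  extend-to-maximal {S} = go (⊃-wellFounded S)
    where
    go : ∀ {S} → Acc _⊃_ S → Independent G S → ∃[ M ] MaximalIndependent G M × S ⊆ M
    go {S} (acc rec) S-ind with any? (λ v → ¬? (v ∈? S) ×-dec independent? (S ∪ ⁅ v ⁆))
    ... | no ¬extendable = S , (S-ind , λ v v∉S S∪v-ind → ¬extendable (v , v∉S , S∪v-ind)) , id
    ... | yes (v , v∉S , S∪v-ind) with go (rec (x∉p⇒p⊂p∪⁅x⁆ v∉S)) S∪v-ind
    ...   | M , M-max , S∪v⊆M = M , M-max , S∪v⊆M ∘ p⊆p∪q ⁅ v ⁆

record Exchange {V : Set} (_~_ : V → V → Set) : Set₁ where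
  field
    S             : Pred V 0ℓ
    S?            : Decidable S
    S-independent : ∀ {u v} → S u → S v → ¬ u ~ v
    x b₁ b₂       : V
    x∈S           : S x
    x~b₁          : x ~ b₁
    x~b₂          : x ~ b₂
    b₁≢b₂         : b₁ ≢ b₂
    b₁≁b₂         : ¬ b₁ ~ b₂
    dominated     : ∀ t → t ~ b₁ ⊎ t ~ b₂ → t ≢ x → ∃[ s ] S s × t ~ s

module _ {N : ℕ} (K : Graph N) where

  exchange-independent : ∀ {M x b₁ b₂} → Independent K M → ¬ Adj K b₁ b₂ →
                         (∀ {u} → u ∈ M → u ≢ x → ¬ (Adj K u b₁ ⊎ Adj K u b₂)) →
                         Independent K (((M - x) ∪ ⁅ b₁ ⁆) ∪ ⁅ b₂ ⁆)
  exchange-independent {M} {x} {b₁} {b₂} M-ind b₁≁b₂ ≁b =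
    Independent-∪⁅⁆ K (Independent-∪⁅⁆ K (Independent-⊆ K (p─q⊆p M ⁅ x ⁆) M-ind) (λ u∈ → M-x≁b u∈ ∘ inj₁))
                      free₂
    where
    M-x≁b : ∀ {u} → u ∈ M - x → ¬ (Adj K u b₁ ⊎ Adj K u b₂)
    M-x≁b u∈ = ≁b (p─q⊆p M ⁅ x ⁆ u∈) (x∈p-y⇒x≢y M u∈)
    free₂ : ∀ {u} → u ∈ (M - x) ∪ ⁅ b₁ ⁆ → ¬ Adj K u b₂
    free₂ u∈ with x∈p∪⁅y⁆⁻ u∈
    ... | inj₁ u∈M-x = M-x≁b u∈M-x ∘ inj₂
    ... | inj₂ refl  = b₁≁b₂

  exchange⇒¬WellCovered : Exchange (Adj K) → ¬ WellCovered K
  exchange⇒¬WellCovered E wc =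
    let M , M-max , S₀⊆M = extend-to-maximal K S₀-independent
        M-ind = proj₁ M-max
        x∈M = S₀⊆M (∈-subset⁺ S? x∈S)
        M′ , M′-max , M₁⊆M′ = extend-to-maximal K (exchange-independent M-ind b₁≁b₂ (M≁b M-ind S₀⊆M))
    in <-irrefl (wc M M′ M-max M′-max)
         (≤-trans (∣p∣<∣p-x∪⁅y⁆∪⁅z⁆∣ (λ b₁∈M → M-ind x b₁ x∈M b₁∈M x~b₁)
                                      (λ b₂∈M → M-ind x b₂ x∈M b₂∈M x~b₂) b₁≢b₂)
                  (p⊆q⇒∣p∣≤∣q∣ M₁⊆M′))
    where
    open Exchange E
    S₀ : Subset N
    S₀ = subset S?
    S₀-independent : Independent K S₀
    S₀-independent u v u∈ v∈ = S-independent (∈-subset⁻ S? u∈) (∈-subset⁻ S? v∈)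
    M≁b : ∀ {M} → Independent K M → S₀ ⊆ M → ∀ {u} → u ∈ M → u ≢ x → ¬ (Adj K u b₁ ⊎ Adj K u b₂)
    M≁b M-ind S₀⊆M {u} u∈M u≢x u~b =
      let s , Ss , u~s = dominated u u~b u≢x in M-ind u s u∈M (S₀⊆M (∈-subset⁺ S? Ss)) u~s

module _ {V W : Set} {_~_ : V → V → Set} {_≈_ : W → W → Set}
         (e : W ↔ V) (≈⇔~ : ∀ {i j} → i ≈ j ⇔ Inverse.to e i ~ Inverse.to e j) where

  open Inverse e using (to; from; strictlyInverseˡ; strictlyInverseʳ)

  private
    ≈⇒~ : ∀ {i v} → i ≈ from v → to i ~ v
    ≈⇒~ {v = v} = subst (_ ~_) (strictlyInverseˡ v) ∘ Equivalence.to ≈⇔~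

    ~⇒≈ : ∀ {i v} → to i ~ v → i ≈ from v
    ~⇒≈ {v = v} = Equivalence.from ≈⇔~ ∘ subst (_ ~_) (sym (strictlyInverseˡ v))

  Exchange-↔ : Exchange _~_ → Exchange _≈_
  Exchange-↔ E = record
    { S             = S ∘ to
    ; S?            = S? ∘ to
    ; S-independent = λ Si Sj → S-independent Si Sj ∘ Equivalence.to ≈⇔~
    ; x             = from x
    ; b₁            = from b₁
    ; b₂            = from b₂
    ; x∈S           = S-from x∈S
    ; x~b₁          = ~⇒≈ (subst (_~ b₁) (sym (strictlyInverseˡ x)) x~b₁)
    ; x~b₂          = ~⇒≈ (subst (_~ b₂) (sym (strictlyInverseˡ x)) x~b₂)
    ; b₁≢b₂         = b₁≢b₂ ∘ from-injective
    ; b₁≁b₂         = b₁≁b₂ ∘ subst (_~ b₂) (strictlyInverseˡ b₁) ∘ ≈⇒~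
    ; dominated     = λ t t~b t≢x →
        let s , Ss , t~s = dominated (to t) (map ≈⇒~ ≈⇒~ t~b) (t≢x ∘ to≡⇒≡from)
        in from s , S-from Ss , ~⇒≈ t~s
    }
    where
    open Exchange E
    S-from : ∀ {v} → S v → S (to (from v))
    S-from {v} = subst S (sym (strictlyInverseˡ v))
    from-injective : ∀ {u v} → from u ≡ from v → u ≡ v
    from-injective {u} {v} eq = trans (sym (strictlyInverseˡ u)) (trans (cong to eq) (strictlyInverseˡ v))
    to≡⇒≡from : ∀ {t v} → to t ≡ v → t ≡ from v
    to≡⇒≡from {t} refl = sym (strictlyInverseʳ t)

module _ {m n : ℕ} (G : Graph m) (H : Graph n) where

  data ProductAdj : Fin m × Fin n → Fin m × Fin n → Set where
    H-edge : ∀ {g h h′} → Adj H h h′ → ProductAdj (g , h) (g , h′)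
    G-edge : ∀ {g g′ h} → Adj G g g′ → ProductAdj (g , h) (g′ , h)

  private
    T-≟-refl : ∀ {k} (i : Fin k) → T (does (i ≟ i))
    T-≟-refl i = subst T (sym (dec-true (i ≟ i) refl)) _

    -- Definitionally the adjacency of G □ H, read in coordinates.
    productAdjᵇ : Fin m × Fin n → Fin m × Fin n → Bool
    productAdjᵇ (g , h) (g′ , h′) = (does (g ≟ g′) ∧ adj H h h′) ∨ (does (h ≟ h′) ∧ adj G g g′)

    T-productAdjᵇ⇔ : ∀ p q → T (productAdjᵇ p q) ⇔ ProductAdj p q
    T-productAdjᵇ⇔ (g , h) (g′ , h′) = mk⇔ to from
      where
      to : T (productAdjᵇ (g , h) (g′ , h′)) → ProductAdj (g , h) (g′ , h′)
      to t with Equivalence.to (T-∨ {does (g ≟ g′) ∧ adj H h h′}) t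
      ... | inj₁ t₁ with g ≟ g′ | Equivalence.to (T-∧ {does (g ≟ g′)}) t₁
      ...   | yes refl | _ , h~h′ = H-edge h~h′
      to t | inj₂ t₂ with h ≟ h′ | Equivalence.to (T-∧ {does (h ≟ h′)}) t₂
      ...   | yes refl | _ , g~g′ = G-edge g~g′
      from : ProductAdj (g , h) (g′ , h′) → T (productAdjᵇ (g , h) (g′ , h′))
      from (H-edge h~h′) = Equivalence.from T-∨ (inj₁ (Equivalence.from T-∧ (T-≟-refl g , h~h′)))
      from (G-edge g~g′) = Equivalence.from T-∨ (inj₂ (Equivalence.from T-∧ (T-≟-refl h , g~g′)))

  ProductAdj⇒ : ∀ {g h g′ h′} → ProductAdj (g , h) (g′ , h′) →
                (g ≡ g′ × Adj H h h′) ⊎ (h ≡ h′ × Adj G g g′)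
  ProductAdj⇒ (H-edge h~h′) = inj₁ (refl , h~h′)
  ProductAdj⇒ (G-edge g~g′) = inj₂ (refl , g~g′)

  □-adj⇔ : ∀ {i j} → Adj (G □ H) i j ⇔ ProductAdj (remQuot n i) (remQuot n j)
  □-adj⇔ {i} {j} = T-productAdjᵇ⇔ (remQuot n i) (remQuot n j)

pattern ∈Na×Ny a~g g≢b y~h = inj₁ (a~g , g≢b , y~h)
pattern ∈Nb×Nv b~g v~h h≢y = inj₂ (inj₁ (b~g , v~h , h≢y))
pattern ≡x g≡b h≡y         = inj₂ (inj₂ (g≡b , h≡y))

cherries⇒exchange : ∀ {m n} {G : Graph m} {H : Graph n} → GirthAtLeast4 G → GirthAtLeast4 H →
                    Cherry G → Cherry H → Exchange (ProductAdj G H)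
cherries⇒exchange {m} {n} {G} {H} G-girth H-girth
                  (a , b , a′ , a~b , a~a′ , b≢a′) (v , y , w , v~y , v~w , y≢w) =
  record
    { S             = Chosen
    ; S?            = chosen?
    ; S-independent = chosen-independent
    ; x             = b , y
    ; b₁            = a , y
    ; b₂            = b , v
    ; x∈S           = ≡x refl refl
    ; x~b₁          = G-edge (Adj-sym G a~b)
    ; x~b₂          = H-edge (Adj-sym H v~y)
    ; b₁≢b₂         = Adj⇒≢ G a~b ∘ cong proj₁
    ; b₁≁b₂         = ay≁bv
    ; dominated     = dominated
    }
  where
  ¬Adj-G : ∀ {c g g′} → Adj G c g → Adj G c g′ → ¬ Adj G g g′
  ¬Adj-G = common-neighbour⇒¬Adj G G-girth
  ¬Adj-H : ∀ {c h h′} → Adj H c h → Adj H c h′ → ¬ Adj H h h′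
  ¬Adj-H = common-neighbour⇒¬Adj H H-girth

  Chosen : Pred (Fin m × Fin n) 0ℓ
  Chosen (g , h) = (Adj G a g × g ≢ b × Adj H y h) ⊎ (Adj G b g × Adj H v h × h ≢ y) ⊎ (g ≡ b × h ≡ y)

  chosen? : Decidable Chosen
  chosen? (g , h) = T? (adj G a g) ×-dec ¬? (g ≟ b) ×-dec T? (adj H y h)
             ⊎-dec T? (adj G b g) ×-dec T? (adj H v h) ×-dec ¬? (h ≟ y)
             ⊎-dec (g ≟ b) ×-dec (h ≟ y)

  chosen-independent : ∀ {p q} → Chosen p → Chosen q → ¬ ProductAdj G H p q
  chosen-independent (∈Na×Ny _ _ y~h₁)   (∈Na×Ny _ _ y~h₂)   (H-edge h₁~h₂) = ¬Adj-H y~h₁ y~h₂ h₁~h₂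
  chosen-independent (∈Na×Ny a~g₁ _ _)   (∈Na×Ny a~g₂ _ _)   (G-edge g₁~g₂) = ¬Adj-G a~g₁ a~g₂ g₁~g₂
  chosen-independent (∈Na×Ny a~g _ _)    (∈Nb×Nv b~g _ _)    (H-edge _)     = ¬Adj-G (Adj-sym G a~g) (Adj-sym G b~g) a~b
  chosen-independent (∈Nb×Nv b~g _ _)    (∈Na×Ny a~g _ _)    (H-edge _)     = ¬Adj-G (Adj-sym G a~g) (Adj-sym G b~g) a~b
  chosen-independent (∈Na×Ny _ _ y~h)    (∈Nb×Nv _ v~h _)    (G-edge _)     = ¬Adj-H (Adj-sym H v~h) (Adj-sym H y~h) v~y
  chosen-independent (∈Nb×Nv _ v~h _)    (∈Na×Ny _ _ y~h)    (G-edge _)     = ¬Adj-H (Adj-sym H v~h) (Adj-sym H y~h) v~y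
  chosen-independent (∈Na×Ny _ g≢b _)    (≡x refl refl)      (H-edge _)     = g≢b refl
  chosen-independent (≡x refl refl)      (∈Na×Ny _ g≢b _)    (H-edge _)     = g≢b refl
  chosen-independent (∈Na×Ny _ _ y~y)    (≡x refl refl)      (G-edge _)     = Adj⇒≢ H y~y refl
  chosen-independent (≡x refl refl)      (∈Na×Ny _ _ y~y)    (G-edge _)     = Adj⇒≢ H y~y refl
  chosen-independent (∈Nb×Nv _ v~h₁ _)   (∈Nb×Nv _ v~h₂ _)   (H-edge h₁~h₂) = ¬Adj-H v~h₁ v~h₂ h₁~h₂
  chosen-independent (∈Nb×Nv b~g₁ _ _)   (∈Nb×Nv b~g₂ _ _)   (G-edge g₁~g₂) = ¬Adj-G b~g₁ b~g₂ g₁~g₂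
  chosen-independent (∈Nb×Nv b~b _ _)    (≡x refl refl)      (H-edge _)     = Adj⇒≢ G b~b refl
  chosen-independent (≡x refl refl)      (∈Nb×Nv b~b _ _)    (H-edge _)     = Adj⇒≢ G b~b refl
  chosen-independent (∈Nb×Nv _ _ h≢y)    (≡x refl refl)      (G-edge _)     = h≢y refl
  chosen-independent (≡x refl refl)      (∈Nb×Nv _ _ h≢y)    (G-edge _)     = h≢y refl
  chosen-independent (≡x refl refl)      (≡x refl refl)      (H-edge y~y)   = Adj⇒≢ H y~y refl
  chosen-independent (≡x refl refl)      (≡x refl refl)      (G-edge b~b)   = Adj⇒≢ G b~b refl

  ay≁bv : ¬ ProductAdj G H (a , y) (b , v)
  ay≁bv r with ProductAdj⇒ G H r
  ... | inj₁ (a≡b , _) = Adj⇒≢ G a~b a≡b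
  ... | inj₂ (y≡v , _) = Adj⇒≢ H v~y (sym y≡v)

  dominated : ∀ t → ProductAdj G H t (a , y) ⊎ ProductAdj G H t (b , v) → t ≢ (b , y) →
              ∃[ s ] Chosen s × ProductAdj G H t s
  dominated (_ , h) (inj₁ (H-edge h~y)) _ =
    (a′ , h) , ∈Na×Ny a~a′ (b≢a′ ∘ sym) (Adj-sym H h~y) , G-edge a~a′
  dominated (g , _) (inj₁ (G-edge g~a)) t≢x =
    (g , v) , ∈Na×Ny (Adj-sym G g~a) (t≢x ∘ cong (_, y)) (Adj-sym H v~y) , H-edge (Adj-sym H v~y)
  dominated (_ , h) (inj₂ (H-edge h~v)) t≢x =
    (a , h) , ∈Nb×Nv (Adj-sym G a~b) (Adj-sym H h~v) (t≢x ∘ cong (b ,_)) , G-edge (Adj-sym G a~b)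
  dominated (g , _) (inj₂ (G-edge g~b)) _ =
    (g , w) , ∈Nb×Nv (Adj-sym G g~b) v~w (y≢w ∘ sym) , H-edge v~w

lemma3p5 : ∀ {m n} (G : Graph m) (H : Graph n) →
    Connected G → Connected H →
    3 ≤ order G → 3 ≤ order H →
    GirthAtLeast4 G → GirthAtLeast4 H →
    ¬ WellCovered (G □ H)
lemma3p5 G H G-connected H-connected 3≤m 3≤n G-girth H-girth =
  exchange⇒¬WellCovered (G □ H)
    (Exchange-↔ *↔× (□-adj⇔ G H)
      (cherries⇒exchange G-girth H-girth (connected⇒cherry G G-connected 3≤m)
                                         (connected⇒cherry H H-connected 3≤n)))
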